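{- For every integer $x\ge 2$, \[ x! \bmod P_2(x) \;=\; x\left\lfloor \frac{x}{p_{\pi(x)+1}-1}\right\rfloor . \]
   Context: $P_2(x)=\binom{x+1}{2}=\frac{x(x+1)}{2}$ is the $x$th triangular number. $\pi$ is the prime-counting function and $p_k$ is the $k$th prime, so $p_{\pi(x)+1}$ is the smallest prime greater than $x$. For integers $a\ge 0$, $b\ge 1$, $a \bmod b$ denotes the unique remainder $c$ with $0\le c<b$ and $a\equiv c\pmod b$. -}

module Defs where

open import Data.Nat using (ℕ; zero; suc; _*_; _∸_; _<_; _≤_; _/_; _%_)
open import Data.Nat.Primality using (Prime)
open import Data.Product using (_×_)

-- P₂(x) = binom(x+1,2) = x(x+1)/2, the x-th triangular number
P₂ : ℕ → ℕ
P₂ x = (x * suc x) / 2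

-- floor division ⌊ m / n ⌋ (convention: 0 when n = 0; never used with n = 0 below)
⌊_/_⌋ : ℕ → ℕ → ℕ
⌊ m / zero ⌋ = 0
⌊ m / suc n ⌋ = m / suc n

-- p is p_{π(x)+1}, i.e. the smallest prime strictly greater than x
IsNextPrime : ℕ → ℕ → Set
IsNextPrime x p = Prime p × x < p × (∀ q → Prime q → x < q → p ≤ q)

-- a mod b (convention: a when b = 0; never used with b = 0 below)
_mod_ : ℕ → ℕ → ℕ
a mod zero = a
a mod suc b = a % suc b

{-# OPTIONS --safe #-}
-- If p = x + 1 is prime, Wilson's theorem in the form (p − 2)! ≡ 1 (mod p),
-- proved by pairing each of 2, …, p − 2 with its inverse (never itself, since
-- only ±1 are self-inverse mod a prime), gives x! = x + K·x(x + 1) = x + 2K·P₂(x);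
-- as x < P₂(x), x! mod P₂(x) = x = x⌊x/x⌋.
-- Otherwise p − 1 > x and x + 1 = ab is composite; a and b (or a and 2a when
-- a = b ≥ 3) are distinct factors of (x − 1)!, so x + 1 ∣ 2·(x − 1)!. Hence
-- 2·P₂(x) = x(x + 1) divides 2·x!, and x! mod P₂(x) = 0 = x⌊x/(p − 1)⌋.
module Submission where

open import Defs
open import Data.Nat
  using (ℕ; zero; suc; _+_; _*_; _∸_; _≤_; _<_; _!; z≤n; s≤s; NonZero; NonTrivial; _/_; _%_; z<s;
         >-nonZero; nonTrivial⇒n>1; n>1⇒nonTrivial)
open import Data.Nat.Properties
open import Algebra.Properties.CommutativeSemigroup *-commutativeSemigroup using (x∙yz≈y∙xz)
open import Data.Nat.DivMod hiding (_mod_)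
open import Data.Nat.Divisibility
open import Data.Nat.Primality using (Prime; Composite; composite; ¬composite[1]; euclidsLemma; ¬prime⇒composite)
open import Data.Nat.Coprimality using (prime⇒coprime; coprime-Bézout)
open import Data.Nat.GCD using (module Bézout)
open import Data.Nat.ListAction using (product)
open import Data.Nat.ListAction.Properties using (product-↭)
open import Data.Nat.Tactic.RingSolver using (solve-∀)
open import Data.List using (List; []; _∷_; _++_; length)
open import Data.List.Membership.Propositional using (_∈_)
open import Data.List.Membership.Propositional.Properties using (∈-∃++)
open import Data.List.Relation.Unary.All as All using (All; []; _∷_)
open import Data.List.Relation.Unary.Any using (here; there)
open import Data.List.Relation.Unary.Unique.Propositional using (Unique; []; _∷_)
open import Data.List.Relation.Binary.Permutation.Propositional using (_↭_; ↭-sym; ↭⇒↭ₛ)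
open import Data.List.Relation.Binary.Permutation.Propositional.Properties
  using (shift; ↭-length; ∈-resp-↭; All-resp-↭)
open import Data.Product using (∃-syntax; _×_; _,_; proj₂)
open import Data.Sum using (_⊎_; inj₁; inj₂; [_,_]′)
open import Relation.Nullary using (¬_; contradiction)
open import Relation.Binary.Definitions using (tri<; tri≈; tri>)
open import Relation.Binary.PropositionalEquality
open import Data.List.Relation.Binary.Permutation.Setoid.Properties (setoid ℕ) using (Unique-resp-↭)

∈-∃↭ : ∀ {A : Set} {x : A} {xs : List A} → x ∈ xs → ∃[ ys ] xs ↭ x ∷ ys
∈-∃↭ x∈xs with ∈-∃++ x∈xs
... | ys , zs , refl = ys ++ zs , shift _ ys zs

%≡%⇒∣∸ : ∀ m o {n} .{{_ : NonZero n}} → m % n ≡ o % n → n ∣ m ∸ o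
%≡%⇒∣∸ m o {n} eq = divides (m / n ∸ o / n) (begin
  m ∸ o                                     ≡⟨ cong₂ _∸_ (m≡m%n+[m/n]*n m n) (m≡m%n+[m/n]*n o n) ⟩
  (m % n + m / n * n) ∸ (o % n + o / n * n) ≡⟨ cong (λ r → (r + m / n * n) ∸ (o % n + o / n * n)) eq ⟩
  (o % n + m / n * n) ∸ (o % n + o / n * n) ≡⟨ [m+n]∸[m+o]≡n∸o (o % n) _ _ ⟩
  m / n * n ∸ o / n * n                     ≡⟨ *-distribʳ-∸ n (m / n) (o / n) ⟨
  (m / n ∸ o / n) * n                       ∎)
  where open ≡-Reasoning

*-congˡ-% : ∀ m {a b n} .{{_ : NonZero n}} → a % n ≡ b % n → (m * a) % n ≡ (m * b) % n
*-congˡ-% m {a} {b} {n} eq = begin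
  (m * a) % n             ≡⟨ %-distribˡ-* m a n ⟩
  (m % n * (a % n)) % n   ≡⟨ cong (λ r → (m % n * r) % n) eq ⟩
  (m % n * (b % n)) % n   ≡⟨ %-distribˡ-* m b n ⟨
  (m * b) % n             ∎
  where open ≡-Reasoning

<∧∣⇒≡0 : ∀ {m n} → m < n → n ∣ m → m ≡ 0
<∧∣⇒≡0 {zero} _ _ = refl
<∧∣⇒≡0 {suc _} m<n n∣m = contradiction n∣m (>⇒∤ m<n)

Inverses : (n : ℕ) .{{_ : NonZero n}} → ℕ → ℕ → Set
Inverses n c d = (c * d) % n ≡ 1 % n

InversePaired : (n : ℕ) .{{_ : NonZero n}} → List ℕ → Set
InversePaired n L = ∀ {c} → c ∈ L → ∃[ d ] d ∈ L × d ≢ c × Inverses n c d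

pred-self-inverse : ∀ n .{{_ : NonZero n}} → Inverses n (n ∸ 1) (n ∸ 1)
pred-self-inverse (suc zero) = refl
pred-self-inverse (suc (suc r)) =
  trans (cong (_% suc (suc r)) (square r)) ([m+kn]%n≡m%n 1 r (suc (suc r)))
  where
  square : ∀ r → suc r * suc r ≡ 1 + r * suc (suc r)
  square = solve-∀

module _ {n : ℕ} .{{_ : NonZero n}} where

  Inverses-sym : ∀ {c d} → Inverses n c d → Inverses n d c
  Inverses-sym {c} {d} = subst (λ r → r % n ≡ 1 % n) (*-comm c d)

  Inverses-%ʳ : ∀ {c d} → Inverses n c d → Inverses n c (d % n)
  Inverses-%ʳ {c} {d} cd = trans (*-congˡ-% c (m%n%n≡m%n d n)) cd

  inverse-unique : ∀ {a b c} → a < n → b < n → Inverses n a c → Inverses n b c → a ≡ b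
  inverse-unique {a} {b} {c} a<n b<n ac bc = begin
    a                   ≡⟨ m<n⇒m%n≡m a<n ⟨
    a % n               ≡⟨ cong (_% n) (*-identityʳ a) ⟨
    (a * 1) % n         ≡⟨ *-congˡ-% a bc ⟨
    (a * (b * c)) % n   ≡⟨ cong (_% n) (x∙yz≈y∙xz a b c) ⟩
    (b * (a * c)) % n   ≡⟨ *-congˡ-% b ac ⟩
    (b * 1) % n         ≡⟨ cong (_% n) (*-identityʳ b) ⟩
    b % n               ≡⟨ m<n⇒m%n≡m b<n ⟩
    b                   ∎
    where open ≡-Reasoning

  inversePaired⇒product≡1 : ∀ L → Unique L → All (_< n) L → InversePaired n L →
                            product L % n ≡ 1 % n
  inversePaired⇒product≡1 L = go (length L) L ≤-refl
    where
    go : ∀ k L → length L ≤ k → Unique L → All (_< n) L → InversePaired n L →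
         product L % n ≡ 1 % n
    go _ [] _ _ _ _ = refl
    go (suc k) (a ∷ t) (s≤s |t|≤k) (a∉t ∷ t-unique) (a<n ∷ t<n) paired
      with paired (here refl)
    ... | b , here refl , b≢a , _ = contradiction refl b≢a
    ... | b , there b∈t , _ , ab with ∈-∃↭ b∈t
    ... | M , σ
      with Unique-resp-↭ (↭⇒↭ₛ σ) t-unique | All-resp-↭ σ a∉t | All-resp-↭ σ t<n
    ... | b∉M ∷ M-unique | _ ∷ a∉M | b<n ∷ M<n = begin
      (a * product t) % n                 ≡⟨ cong (λ r → (a * r) % n) (product-↭ σ) ⟩
      (a * (b * product M)) % n           ≡⟨ cong (_% n) (*-assoc a b _) ⟨
      (a * b * product M) % n             ≡⟨ %-distribˡ-* (a * b) (product M) n ⟩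
      ((a * b) % n * (product M % n)) % n ≡⟨ cong₂ (λ u v → (u * v) % n) ab
                                               (go k M |M|≤k M-unique M<n M-paired) ⟩
      (1 % n * (1 % n)) % n               ≡⟨ %-distribˡ-* 1 1 n ⟨
      1 % n                               ∎
      where
      open ≡-Reasoning
      |M|≤k : length M ≤ k
      |M|≤k = ≤-trans (n≤1+n _) (subst (_≤ k) (↭-length σ) |t|≤k)
      M-paired : InversePaired n M
      M-paired {c} c∈M with paired (there (∈-resp-↭ (↭-sym σ) (there c∈M)))
      ... | _ , here refl , _ , ca =
        contradiction (inverse-unique b<n c<n (Inverses-sym {c = a} {d = b} ab) ca)
                      (All.lookup b∉M c∈M)
        where
        c<n : c < n
        c<n = All.lookup M<n c∈M
      ... | d , there d∈t , d≢c , cd with ∈-resp-↭ σ d∈t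
      ...   | here refl =
        contradiction (inverse-unique a<n (All.lookup M<n c∈M) ab cd) (All.lookup a∉M c∈M)
      ...   | there d∈M = d , d∈M , d≢c , cd

[2‥_] : ℕ → List ℕ
[2‥ zero ] = []
[2‥ suc zero ] = []
[2‥ suc (suc n) ] = suc (suc n) ∷ [2‥ suc n ]

product-[2‥n]≡n! : ∀ n → product [2‥ n ] ≡ n !
product-[2‥n]≡n! zero = refl
product-[2‥n]≡n! (suc zero) = refl
product-[2‥n]≡n! (suc (suc n)) = cong (suc (suc n) *_) (product-[2‥n]≡n! (suc n))

∈-[2‥]⁻ : ∀ {d} n → d ∈ [2‥ n ] → 1 < d × d ≤ n
∈-[2‥]⁻ (suc (suc n)) (here refl) = s≤s (s≤s z≤n) , ≤-refl
∈-[2‥]⁻ (suc (suc n)) (there d∈) with ∈-[2‥]⁻ (suc n) d∈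
... | 1<d , d≤1+n = 1<d , m≤n⇒m≤1+n d≤1+n

∈-[2‥]⁺ : ∀ {d} n → 1 < d → d ≤ n → d ∈ [2‥ n ]
∈-[2‥]⁺ zero 1<d d≤0 = contradiction d≤0 (<⇒≱ (<-trans z<s 1<d))
∈-[2‥]⁺ (suc zero) 1<d d≤1 = contradiction d≤1 (<⇒≱ 1<d)
∈-[2‥]⁺ (suc n@(suc _)) 1<d d≤1+n =
  [ (λ d<1+n → there (∈-[2‥]⁺ n 1<d (≤-pred d<1+n))) , here ]′ (m≤n⇒m<n∨m≡n d≤1+n)

[2‥]-unique : ∀ n → Unique [2‥ n ]
[2‥]-unique zero = []
[2‥]-unique (suc zero) = []
[2‥]-unique (suc (suc n)) =
  All.tabulate (λ d∈ → >⇒≢ (s≤s (proj₂ (∈-[2‥]⁻ (suc n) d∈)))) ∷ [2‥]-unique (suc n)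

module _ {r : ℕ} (p-prime : Prime (2 + r)) where
  private
    p : ℕ
    p = 2 + r

  inverse-exists : ∀ {c} → 0 < c → c < p → ∃[ d ] Inverses p c d
  inverse-exists {c} 0<c c<p
    with coprime-Bézout (prime⇒coprime p-prime {{>-nonZero 0<c}} c<p)
  ... | Bézout.-+ x y 1+xp≡yc = y , (begin
    (c * y) % p     ≡⟨ cong (_% p) (trans (*-comm c y) (sym 1+xp≡yc)) ⟩
    (1 + x * p) % p ≡⟨ [m+kn]%n≡m%n 1 x p ⟩
    1 % p           ∎)
    where open ≡-Reasoning
  ... | Bézout.+- x y 1+yc≡xp = y * suc r , (begin
    (c * (y * suc r)) % p         ≡⟨ [m+kn]%n≡m%n (c * (y * suc r)) x p ⟨
    (c * (y * suc r) + x * p) % p ≡⟨ cong (λ t → (c * (y * suc r) + t) % p) 1+yc≡xp ⟨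
    (c * (y * suc r) + (1 + y * c)) % p ≡⟨ cong (_% p) (rearrange c y r) ⟩
    (1 + c * y * p) % p           ≡⟨ [m+kn]%n≡m%n 1 (c * y) p ⟩
    1 % p                         ∎)
    where
    open ≡-Reasoning
    rearrange : ∀ c y r → c * (y * suc r) + (1 + y * c) ≡ 1 + c * y * (2 + r)
    rearrange = solve-∀

  self-inverse⇒≡1⊎≡1+r : ∀ {c} → c < p → Inverses p c c → c ≡ 1 ⊎ c ≡ suc r
  self-inverse⇒≡1⊎≡1+r {suc k} (s≤s k<1+r) kk with euclidsLemma k (2 + k) p-prime p∣k[2+k]
    where
    square : ∀ k → 1 + k * (2 + k) ≡ suc k * suc k
    square = solve-∀
    p∣k[2+k] : p ∣ k * (2 + k)
    p∣k[2+k] = subst (p ∣_) (m+n∸m≡n 1 (k * (2 + k)))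
                     (%≡%⇒∣∸ (1 + k * (2 + k)) 1 (trans (cong (_% p) (square k)) kk))
  ... | inj₁ p∣k = inj₁ (cong suc (<∧∣⇒≡0 (m≤n⇒m≤1+n k<1+r) p∣k))
  ... | inj₂ p∣2+k = inj₂ (cong suc (≤-antisym (≤-pred k<1+r) (≤-pred (≤-pred (∣⇒≤ p∣2+k)))))

  [2‥p∸2]-inversePaired : InversePaired p [2‥ r ]
  [2‥p∸2]-inversePaired {c} c∈ with ∈-[2‥]⁻ r c∈
  ... | 1<c , c≤r with inverse-exists (<-trans z<s 1<c) (m≤n⇒m≤1+n (s≤s c≤r))
  ... | d , cd = d % p , ∈-[2‥p∸2] (m%n<n d p) d′≢0 d′≢1 d′≢1+r , d′≢c , cd′
    where
    c<p : c < p
    c<p = m≤n⇒m≤1+n (s≤s c≤r)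
    cd′ : Inverses p c (d % p)
    cd′ = Inverses-%ʳ {n = p} {c} {d} cd
    ∈-[2‥p∸2] : ∀ {e} → e < p → e ≢ 0 → e ≢ 1 → e ≢ suc r → e ∈ [2‥ r ]
    ∈-[2‥p∸2] {zero} _ e≢0 _ _ = contradiction refl e≢0
    ∈-[2‥p∸2] {suc zero} _ _ e≢1 _ = contradiction refl e≢1
    ∈-[2‥p∸2] {suc (suc _)} e<p _ _ e≢1+r =
      ∈-[2‥]⁺ r (s≤s (s≤s z≤n)) (≤-pred (≤∧≢⇒< (≤-pred e<p) e≢1+r))
    d′≢0 : d % p ≢ 0
    d′≢0 d′≡0 = 0≢1+n (trans (cong (_% p) (sym (*-zeroʳ c))) (subst (Inverses p c) d′≡0 cd′))
    d′≢1 : d % p ≢ 1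
    d′≢1 d′≡1 = <⇒≢ 1<c (sym (inverse-unique {n = p} c<p (s≤s (s≤s z≤n))
                                 (subst (Inverses p c) d′≡1 cd′) refl))
    d′≢1+r : d % p ≢ suc r
    d′≢1+r d′≡1+r = <⇒≱ (s≤s c≤r) (≤-reflexive (sym (inverse-unique {n = p} c<p ≤-refl
                                 (subst (Inverses p c) d′≡1+r cd′) (pred-self-inverse p))))
    d′≢c : d % p ≢ c
    d′≢c d′≡c with self-inverse⇒≡1⊎≡1+r c<p (subst (Inverses p c) d′≡c cd′)
    ... | inj₁ c≡1 = <⇒≢ 1<c (sym c≡1)
    ... | inj₂ c≡1+r = <⇒≱ (s≤s c≤r) (≤-reflexive (sym c≡1+r))

  wilson : r ! % p ≡ 1
  wilson = begin
    r ! % p             ≡⟨ cong (_% p) (product-[2‥n]≡n! r) ⟨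
    product [2‥ r ] % p ≡⟨ inversePaired⇒product≡1 [2‥ r ] ([2‥]-unique r)
                             (All.tabulate (λ e∈ → m≤n⇒m≤1+n (s≤s (proj₂ (∈-[2‥]⁻ r e∈)))))
                             [2‥p∸2]-inversePaired ⟩
    1                   ∎
    where open ≡-Reasoning

m<n≤o⇒m*n∣o! : ∀ {m n o} → 0 < m → m < n → n ≤ o → m * n ∣ o !
m<n≤o⇒m*n∣o! {suc m} {suc n} {o} _ (s≤s 1+m≤n) 1+n≤o = begin
  suc m * suc n ≡⟨ *-comm (suc m) (suc n) ⟩
  suc n * suc m ∣⟨ *-monoʳ-∣ (suc n) (∣-trans (m∣m*n (m !)) (m≤n⇒m!∣n! 1+m≤n)) ⟩
  suc n !       ∣⟨ m≤n⇒m!∣n! 1+n≤o ⟩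
  o !           ∎
  where open ∣-Reasoning

n≤m*n∸2 : ∀ {m n} → 2 ≤ m → 2 ≤ n → n ≤ m * n ∸ 2
n≤m*n∸2 {m} {n} 2≤m 2≤n = m+n≤o⇒m≤o∸n n (begin
  n + 2 ≤⟨ +-monoʳ-≤ n 2≤n ⟩
  n + n ≡⟨ cong (n +_) (+-identityʳ n) ⟨
  2 * n ≤⟨ *-monoˡ-≤ n 2≤m ⟩
  m * n ∎)
  where open ≤-Reasoning

n+n≤n*n∸2 : ∀ {n} → 3 ≤ n → n + n ≤ n * n ∸ 2
n+n≤n*n∸2 {n} 3≤n = m+n≤o⇒m≤o∸n (n + n) (begin
  n + n + 2   ≤⟨ +-monoʳ-≤ (n + n) (≤-trans (n≤1+n 2) 3≤n) ⟩
  n + n + n   ≡⟨ +-assoc n n n ⟩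
  n + (n + n) ≡⟨ cong (λ t → n + (n + t)) (+-identityʳ n) ⟨
  3 * n       ≤⟨ *-monoˡ-≤ n 3≤n ⟩
  n * n       ∎)
  where open ≤-Reasoning

n*n∣2*[n*n∸2]! : ∀ n → 2 ≤ n → n * n ∣ 2 * (n * n ∸ 2) !
n*n∣2*[n*n∸2]! 1 (s≤s ())
n*n∣2*[n*n∸2]! 2 _ = ∣-refl
n*n∣2*[n*n∸2]! n@(suc (suc (suc _))) _ = begin
  n * n             ∣⟨ *-monoʳ-∣ n (∣m∣n⇒∣m+n (∣-refl {n}) ∣-refl) ⟩
  n * (n + n)       ∣⟨ m<n≤o⇒m*n∣o! z<s (m<m+n n z<s) (n+n≤n*n∸2 (s≤s (s≤s (s≤s z≤n)))) ⟩
  (n * n ∸ 2) !     ∣⟨ n∣m*n 2 ⟩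
  2 * (n * n ∸ 2) ! ∎
  where open ∣-Reasoning

2≤m<n⇒m*n∣[m*n∸2]! : ∀ {m n} → 2 ≤ m → m < n → m * n ∣ (m * n ∸ 2) !
2≤m<n⇒m*n∣[m*n∸2]! 2≤m m<n =
  m<n≤o⇒m*n∣o! (<-trans z<s 2≤m) m<n (n≤m*n∸2 2≤m (≤-trans 2≤m (<⇒≤ m<n)))

m*n∣2*[m*n∸2]! : ∀ {m n} → 2 ≤ m → 2 ≤ n → m * n ∣ 2 * (m * n ∸ 2) !
m*n∣2*[m*n∸2]! {m} {n} 2≤m 2≤n with <-cmp m n
... | tri< m<n _ _ = ∣-trans (2≤m<n⇒m*n∣[m*n∸2]! 2≤m m<n) (n∣m*n 2)
... | tri≈ _ refl _ = n*n∣2*[n*n∸2]! m 2≤m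
... | tri> _ _ n<m = subst (λ k → k ∣ 2 * (k ∸ 2) !) (*-comm n m)
                       (∣-trans (2≤m<n⇒m*n∣[m*n∸2]! 2≤n n<m) (n∣m*n 2))

composite⇒∣2*[n∸2]! : ∀ {n} → Composite n → n ∣ 2 * (n ∸ 2) !
composite⇒∣2*[n∸2]! (composite {d} d<n d∣n) =
  subst (λ k → k ∣ 2 * (k ∸ 2) !) (sym (m∣n⇒n≡quotient*m d∣n))
        (m*n∣2*[m*n∸2]! (quotient>1 d∣n d<n) (nonTrivial⇒n>1 d))

2∣n*[1+n] : ∀ n → 2 ∣ n * suc n
2∣n*[1+n] zero = divides 0 refl
2∣n*[1+n] (suc n) = subst (2 ∣_) (sym (split n)) (∣m∣n⇒∣m+n (2∣n*[1+n] n) (n∣m*n (suc n)))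
  where
  split : ∀ n → suc n * suc (suc n) ≡ n * suc n + suc n * 2
  split = solve-∀

P₂[x]*2≡x*[1+x] : ∀ x → P₂ x * 2 ≡ x * suc x
P₂[x]*2≡x*[1+x] x = m/n*n≡m (2∣n*[1+n] x)

x<P₂x : ∀ {x} → 2 ≤ x → x < P₂ x
x<P₂x {x@(suc _)} 2≤x = *-cancelʳ-< 2 x (P₂ x) (begin-strict
  x * 2      <⟨ *-monoʳ-< x (s≤s 2≤x) ⟩
  x * suc x  ≡⟨ P₂[x]*2≡x*[1+x] x ⟨
  P₂ x * 2   ∎)
  where open ≤-Reasoning

prime[1+x]⇒x!%P₂x≡x : ∀ {x} .{{_ : NonZero (P₂ x)}} → 2 ≤ x → Prime (suc x) → x ! % P₂ x ≡ x
prime[1+x]⇒x!%P₂x≡x {x@(suc k)} 2≤x p-prime = begin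
  (x * k !) % P₂ x                  ≡⟨ cong (λ t → (x * t) % P₂ x) k!≡1+K*[1+x] ⟩
  (x * (1 + K * suc x)) % P₂ x      ≡⟨ cong (_% P₂ x) (expand x K) ⟩
  (x + K * (x * suc x)) % P₂ x      ≡⟨ %-remove-+ʳ x (∣-trans P₂x∣x*[1+x] (n∣m*n K)) ⟩
  x % P₂ x                          ≡⟨ m<n⇒m%n≡m (x<P₂x 2≤x) ⟩
  x                                 ∎
  where
  open ≡-Reasoning
  K : ℕ
  K = k ! / suc x
  k!≡1+K*[1+x] : k ! ≡ 1 + K * suc x
  k!≡1+K*[1+x] = trans (m≡m%n+[m/n]*n (k !) (suc x)) (cong (_+ K * suc x) (wilson p-prime))
  expand : ∀ x K → x * (1 + K * suc x) ≡ x + K * (x * suc x)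
  expand = solve-∀
  P₂x∣x*[1+x] : P₂ x ∣ x * suc x
  P₂x∣x*[1+x] = subst (P₂ x ∣_) (P₂[x]*2≡x*[1+x] x) (m∣m*n 2)

composite[1+x]⇒P₂x∣x! : ∀ {x} → Composite (suc x) → P₂ x ∣ x !
composite[1+x]⇒P₂x∣x! {zero} c = contradiction c ¬composite[1]
composite[1+x]⇒P₂x∣x! {x@(suc k)} c = *-cancelʳ-∣ 2 (begin
  P₂ x * 2      ≡⟨ P₂[x]*2≡x*[1+x] x ⟩
  x * suc x     ∣⟨ *-monoʳ-∣ x (composite⇒∣2*[n∸2]! c) ⟩
  x * (2 * k !) ≡⟨ rearrange x (k !) ⟩
  x ! * 2       ∎)
  where
  open ∣-Reasoning
  rearrange : ∀ x f → x * (2 * f) ≡ x * f * 2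
  rearrange = solve-∀

mod≡% : ∀ a n .{{_ : NonZero n}} → a mod n ≡ a % n
mod≡% a (suc n) = refl

⌊/⌋≡/ : ∀ m n .{{_ : NonZero n}} → ⌊ m / n ⌋ ≡ m / n
⌊/⌋≡/ m (suc n) = refl

theorem7p4 : ∀ (x p : ℕ) → 2 ≤ x → IsNextPrime x p →
    (x !) mod P₂ x ≡ x * ⌊ x / (p ∸ 1) ⌋
theorem7p4 x zero _ (_ , () , _)
theorem7p4 x (suc p′) 2≤x (p-prime , s≤s x≤p′ , p-least) = begin
  (x !) mod P₂ x ≡⟨ mod≡% (x !) (P₂ x) ⟩
  x ! % P₂ x     ≡⟨ x!%P₂x≡x*[x/p′] (m≤n⇒m<n∨m≡n x≤p′) ⟩
  x * (x / p′)   ≡⟨ cong (x *_) (⌊/⌋≡/ x p′) ⟨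
  x * ⌊ x / p′ ⌋ ∎
  where
  open ≡-Reasoning
  instance
    x≢0 : NonZero x
    x≢0 = >-nonZero (<-trans z<s 2≤x)
    p′≢0 : NonZero p′
    p′≢0 = >-nonZero (<-≤-trans (<-trans z<s 2≤x) x≤p′)
    P₂x≢0 : NonZero (P₂ x)
    P₂x≢0 = >-nonZero (≤-<-trans z≤n (x<P₂x 2≤x))
    1+x-nonTrivial : NonTrivial (suc x)
    1+x-nonTrivial = n>1⇒nonTrivial (s≤s (<-trans z<s 2≤x))
  x!%P₂x≡x*[x/p′] : x < p′ ⊎ x ≡ p′ → x ! % P₂ x ≡ x * (x / p′)
  x!%P₂x≡x*[x/p′] (inj₂ x≡p′) = begin
    x ! % P₂ x   ≡⟨ prime[1+x]⇒x!%P₂x≡x 2≤x (subst (λ q → Prime (suc q)) (sym x≡p′) p-prime) ⟩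
    x            ≡⟨ *-identityʳ x ⟨
    x * 1        ≡⟨ cong (x *_) (trans (/-congʳ (sym x≡p′)) (n/n≡1 x)) ⟨
    x * (x / p′) ∎
  x!%P₂x≡x*[x/p′] (inj₁ x<p′) = begin
    x ! % P₂ x   ≡⟨ n∣m⇒m%n≡0 (x !) (P₂ x)
                      (composite[1+x]⇒P₂x∣x! (¬prime⇒composite 1+x-not-prime)) ⟩
    0            ≡⟨ *-zeroʳ x ⟨
    x * 0        ≡⟨ cong (x *_) (m<n⇒m/n≡0 x<p′) ⟨
    x * (x / p′) ∎
    where
    1+x-not-prime : ¬ Prime (suc x)
    1+x-not-prime 1+x-prime = <⇒≱ (s≤s x<p′) (p-least (suc x) 1+x-prime ≤-refl)
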